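{- Let $S$ be a finite subset of $\{1,2,\dots\}$ and let $w$ be a permutation of $S$ (a word using each element of $S$ once). Then the equivalence class $\langle w\rangle$ of $w$ under $\sim$ contains a permutation $v=v_1v_2\cdots v_k$ (concatenation of words) such that (a) each $v_i$ is an increasing or decreasing sequence of consecutive integers, and (b) every $u\sim w$ has the form $u=v_1'v_2'\cdots v_k'$ where $v_i'\sim v_i$ for each $i$. Moreover, the permutation $v$ is unique up to reversing those $v_i$ of length two.
   Context: For words whose entries are distinct positive integers, $u\sim v$ means $v$ can be obtained from $u$ by a sequence of interchanges of two adjacent entries differing by exactly $1$. -}

module Defs where

open import Data.Nat using (ℕ; suc; _+_; _<_)
open import Data.List using (List; []; _∷_; _++_; map; upTo; reverse; concat; length)
open import Data.List.Relation.Unary.All using (All)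
open import Data.List.Relation.Binary.Pointwise using (Pointwise)
open import Data.Product using (Σ; ∃; ∃₂; _×_; _,_)
open import Data.Sum using (_⊎_)
open import Relation.Binary.PropositionalEquality using (_≡_)
open import Relation.Binary.Construct.Closure.ReflexiveTransitive using (Star)

Word : Set
Word = List ℕ

data Step : Word → Word → Set where
  swap : ∀ (xs ys : Word) (a b : ℕ) → (suc a ≡ b ⊎ suc b ≡ a) →
         Step (xs ++ a ∷ b ∷ ys) (xs ++ b ∷ a ∷ ys)

infix 4 _∼_
_∼_ : Word → Word → Set
_∼_ = Star Step

IncRun : Word → Set
IncRun b = ∃₂ λ a m → b ≡ map (a +_) (upTo (suc m))

DecRun : Word → Set
DecRun b = ∃₂ λ a m → b ≡ reverse (map (a +_) (upTo (suc m)))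

Run : Word → Set
Run b = IncRun b ⊎ DecRun b

FactorsAs : Word → List Word → Set
FactorsAs u vs = Σ (List Word) λ us → Pointwise (λ u' v' → u' ∼ v') us vs × concat us ≡ u

GoodDecomp : Word → List Word → Set
GoodDecomp w vs = (w ∼ concat vs) × All Run vs × (∀ u → w ∼ u → FactorsAs u vs)

FlipRel : Word → Word → Set
FlipRel b b' = b' ≡ b ⊎ (length b ≡ 2 × b' ≡ reverse b)

-- Two letters that are not adjacent integers can never be moved past each other, so equivalent
-- words begin (and end) with equal or adjacent letters.
--
-- Existence: insert the letters of w from right to left into a list of runs, merging the new front
-- run with its successor whenever the two, after possibly reversing a run of length two, form one
-- longer run. Neighbouring runs that cannot be merged are separated: no word equivalent to the first
-- ends with a letter adjacent to the first letter of a word equivalent to the second, so every move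
-- on a concatenation of factors takes place inside a single factor.
--
-- Uniqueness: if the first blocks of two decompositions had different lengths, the shorter block
-- would be a proper prefix of the longer run in some equivalent word; swapping the two letters of
-- the run at the end of that prefix gives an equivalent word whose first factor contains a letter
-- outside the shorter block. First blocks of equal length are equivalent runs on the same letters,
-- hence equal up to reversing a block of length two.

module Submission where

open import Defs
open import Level using (0ℓ)
open import Data.Nat using (ℕ; zero; suc; _+_; _<_; _≤_; z≤n; s≤s; _≟_; _≤?_)
open import Data.Nat.Properties
  using (1+n≢n; +-identityʳ; +-suc; +-comm; +-cancelˡ-≡; m≢1+m+n; suc-injective; ≤-refl; ≤-reflexive; ≤-trans; ≤-antisym;
         ≤-pred; <⇒≤; ≤∧≢⇒<; m≤m+n; n≤1+n; m≤n⇒m<n∨m≡n; <-cmp)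
open import Data.List using (List; []; _∷_; _++_; _∷ʳ_; map; upTo; applyUpTo; reverse; concat; length; filter; initLast; _∷ʳ′_)
open import Data.List.Properties
  using (++-assoc; reverse-++; reverse-involutive; unfold-reverse; length-reverse; length-++; map-upTo;
         filter-++; filter-accept; filter-reject; ∷-injective; ∷-injectiveˡ; ∷-injectiveʳ)
open import Data.List.Membership.Propositional using (_∈_)
open import Data.List.Membership.Propositional.Properties using (∈-++⁺ˡ; ∈-++⁺ʳ; ∈-++⁻)
open import Data.List.Relation.Unary.Any using (here; there)
import Data.List.Relation.Unary.Any.Properties as Any
open import Data.List.Relation.Unary.All using (All; []; _∷_; universal) renaming (lookup to All-lookup)
import Data.List.Relation.Unary.All as All
open import Data.List.Relation.Unary.All.Properties using (map⁺)
open import Data.List.Relation.Unary.AllPairs using (_∷_)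
open import Data.List.Relation.Unary.Unique.Propositional using (Unique)
open import Data.List.Relation.Unary.Linked using (Linked; []; [-]; _∷_)
import Data.List.Relation.Unary.Linked as Linked
open import Data.List.Relation.Binary.Pointwise using (Pointwise; []; _∷_)
import Data.List.Relation.Binary.Pointwise as Pointwise
open import Data.List.Relation.Binary.Permutation.Propositional using (_↭_; ↭-refl; ↭-trans; ↭⇒↭ₛ) renaming (swap to ↭-swap)
open import Data.List.Relation.Binary.Permutation.Propositional.Properties using (++⁺ˡ; ∈-resp-↭; ↭-length)
import Data.List.Relation.Binary.Permutation.Setoid.Properties as ↭ₛ
open import Data.Product using (Σ; ∃; ∃₂; _×_; _,_; proj₁)
open import Data.Sum using (_⊎_; inj₁; inj₂)
open import Data.Empty using (⊥; ⊥-elim)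
open import Relation.Nullary using (¬_; Dec; yes; no)
open import Relation.Nullary.Decidable using (map′; _×-dec_; _⊎-dec_)
open import Relation.Unary using (Pred; Decidable)
open import Relation.Binary using (tri<; tri≈; tri>)
open import Relation.Binary.PropositionalEquality
open import Relation.Binary.Construct.Closure.ReflexiveTransitive using (ε; _◅_; _◅◅_; gmap)
import Relation.Binary.Construct.Closure.ReflexiveTransitive as Star

Adjacent : ℕ → ℕ → Set
Adjacent a b = suc a ≡ b ⊎ suc b ≡ a

Adjacent-sym : ∀ {a b} → Adjacent a b → Adjacent b a
Adjacent-sym (inj₁ p) = inj₂ p
Adjacent-sym (inj₂ p) = inj₁ p

Adjacent⇒≢ : ∀ {a b} → Adjacent a b → a ≢ b
Adjacent⇒≢ (inj₁ p) refl = 1+n≢n p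
Adjacent⇒≢ (inj₂ p) refl = 1+n≢n p

Near : ℕ → ℕ → Set
Near a b = a ≡ b ⊎ Adjacent a b

near? : ∀ a b → Dec (Near a b)
near? a b = (a ≟ b) ⊎-dec (suc a ≟ b) ⊎-dec (suc b ≟ a)

Near-sym : ∀ {a b} → Near a b → Near b a
Near-sym (inj₁ e) = inj₁ (sym e)
Near-sym (inj₂ p) = inj₂ (Adjacent-sym p)

Step-sym : ∀ {u v} → Step u v → Step v u
Step-sym (swap xs ys a b p) = swap xs ys b a (Adjacent-sym p)

∼-sym : ∀ {u v} → u ∼ v → v ∼ u
∼-sym = Star.reverse Step-sym

∼-snoc : ∀ {u v w} → u ∼ v → Step v w → u ∼ w
∼-snoc p s = p ◅◅ (s ◅ ε)

Step-++ˡ : ∀ p {u v} → Step u v → Step (p ++ u) (p ++ v)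
Step-++ˡ p (swap xs ys a b q) =
  subst₂ Step (++-assoc p xs (a ∷ b ∷ ys)) (++-assoc p xs (b ∷ a ∷ ys)) (swap (p ++ xs) ys a b q)

Step-++ʳ : ∀ s {u v} → Step u v → Step (u ++ s) (v ++ s)
Step-++ʳ s (swap xs ys a b q) =
  subst₂ Step (sym (++-assoc xs (a ∷ b ∷ ys) s)) (sym (++-assoc xs (b ∷ a ∷ ys) s)) (swap xs (ys ++ s) a b q)

∼-++ˡ : ∀ p {u v} → u ∼ v → p ++ u ∼ p ++ v
∼-++ˡ p = gmap (p ++_) (Step-++ˡ p)

∼-++ʳ : ∀ s {u v} → u ∼ v → u ++ s ∼ v ++ s
∼-++ʳ s = gmap (_++ s) (Step-++ʳ s)

∼-++ : ∀ {u v u′ v′} → u ∼ v → u′ ∼ v′ → u ++ u′ ∼ v ++ v′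
∼-++ {v = v} {u′ = u′} p q = ∼-++ʳ u′ p ◅◅ ∼-++ˡ v q

∼-concat : ∀ {us vs} → Pointwise _∼_ us vs → concat us ∼ concat vs
∼-concat [] = ε
∼-concat (p ∷ ps) = ∼-++ p (∼-concat ps)

reverse-swap : ∀ (xs : Word) a b ys → reverse (xs ++ a ∷ b ∷ ys) ≡ reverse ys ++ b ∷ a ∷ reverse xs
reverse-swap xs a b ys = begin
  reverse (xs ++ a ∷ b ∷ ys)              ≡⟨ reverse-++ xs (a ∷ b ∷ ys) ⟩
  reverse (a ∷ b ∷ ys) ++ reverse xs      ≡⟨ cong (_++ reverse xs) (reverse-++ (a ∷ b ∷ []) ys) ⟩
  (reverse ys ++ b ∷ a ∷ []) ++ reverse xs ≡⟨ ++-assoc (reverse ys) (b ∷ a ∷ []) (reverse xs) ⟩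
  reverse ys ++ b ∷ a ∷ reverse xs        ∎
  where open ≡-Reasoning

Step-reverse : ∀ {u v} → Step u v → Step (reverse u) (reverse v)
Step-reverse (swap xs ys a b p) = subst₂ Step (sym (reverse-swap xs a b ys)) (sym (reverse-swap xs b a ys))
  (swap (reverse ys) (reverse xs) b a (Adjacent-sym p))

∼-reverse : ∀ {u v} → u ∼ v → reverse u ∼ reverse v
∼-reverse = gmap reverse Step-reverse

Step⇒↭ : ∀ {u v} → Step u v → u ↭ v
Step⇒↭ (swap xs ys a b _) = ++⁺ˡ xs (↭-swap a b ↭-refl)

∼⇒↭ : ∀ {u v} → u ∼ v → u ↭ v
∼⇒↭ ε = ↭-refl
∼⇒↭ (s ◅ p) = ↭-trans (Step⇒↭ s) (∼⇒↭ p)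

∼-length : ∀ {u v} → u ∼ v → length u ≡ length v
∼-length p = ↭-length (∼⇒↭ p)

NonEmpty : Word → Set
NonEmpty v = ∃₂ λ x v′ → v ≡ x ∷ v′

∼-NonEmpty : ∀ {u v} → u ∼ v → NonEmpty v → NonEmpty u
∼-NonEmpty {[]} p (_ , _ , refl) with () ← ∼-length p
∼-NonEmpty {x ∷ u} _ _ = x , u , refl

∼-∈ : ∀ {u v x} → u ∼ v → x ∈ u → x ∈ v
∼-∈ p = ∈-resp-↭ (∼⇒↭ p)

∼-Unique : ∀ {u v} → u ∼ v → Unique u → Unique v
∼-Unique p = ↭ₛ.Unique-resp-↭ (setoid ℕ) (↭⇒↭ₛ (∼⇒↭ p))

Unique-++-disjoint : ∀ (xs : Word) {ys x} → Unique (xs ++ ys) → x ∈ xs → x ∈ ys → ⊥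
Unique-++-disjoint (_ ∷ xs) (x∉ ∷ _) (here refl) x∈ys = All-lookup x∉ (∈-++⁺ʳ xs x∈ys) refl
Unique-++-disjoint (_ ∷ xs) (_ ∷ distinct) (there x∈xs) x∈ys = Unique-++-disjoint xs distinct x∈xs x∈ys

Unique-++⁻ʳ : ∀ (xs : Word) {ys} → Unique (xs ++ ys) → Unique ys
Unique-++⁻ʳ [] distinct = distinct
Unique-++⁻ʳ (_ ∷ xs) (_ ∷ distinct) = Unique-++⁻ʳ xs distinct

-- First and last letters of equivalent words

module _ {P : Pred ℕ 0ℓ} (P? : Decidable P) (spread : ∀ {a b} → P a → P b → ¬ Adjacent a b) where

  filter-swap : ∀ {a b} ys → Adjacent a b → filter P? (a ∷ b ∷ ys) ≡ filter P? (b ∷ a ∷ ys)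
  filter-swap {a} {b} ys adj = by-cases (P? a) (P? b)
    where
    open ≡-Reasoning
    by-cases : Dec (P a) → Dec (P b) → filter P? (a ∷ b ∷ ys) ≡ filter P? (b ∷ a ∷ ys)
    by-cases (yes pa) (yes pb) = ⊥-elim (spread pa pb adj)
    by-cases (yes pa) (no ¬pb) = begin
      filter P? (a ∷ b ∷ ys)  ≡⟨ filter-accept P? pa ⟩
      a ∷ filter P? (b ∷ ys)  ≡⟨ cong (a ∷_) (filter-reject P? ¬pb) ⟩
      a ∷ filter P? ys        ≡⟨ filter-accept P? pa ⟨
      filter P? (a ∷ ys)      ≡⟨ filter-reject P? ¬pb ⟨
      filter P? (b ∷ a ∷ ys)  ∎
    by-cases (no ¬pa) (yes pb) = begin
      filter P? (a ∷ b ∷ ys)  ≡⟨ filter-reject P? ¬pa ⟩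
      filter P? (b ∷ ys)      ≡⟨ filter-accept P? pb ⟩
      b ∷ filter P? ys        ≡⟨ cong (b ∷_) (filter-reject P? ¬pa) ⟨
      b ∷ filter P? (a ∷ ys)  ≡⟨ filter-accept P? pb ⟨
      filter P? (b ∷ a ∷ ys)  ∎
    by-cases (no ¬pa) (no ¬pb) = begin
      filter P? (a ∷ b ∷ ys)  ≡⟨ filter-reject P? ¬pa ⟩
      filter P? (b ∷ ys)      ≡⟨ filter-reject P? ¬pb ⟩
      filter P? ys            ≡⟨ filter-reject P? ¬pa ⟨
      filter P? (a ∷ ys)      ≡⟨ filter-reject P? ¬pb ⟨
      filter P? (b ∷ a ∷ ys)  ∎

  Step-filter : ∀ {u v} → Step u v → filter P? u ≡ filter P? v
  Step-filter (swap xs ys a b adj) = begin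
    filter P? (xs ++ a ∷ b ∷ ys)             ≡⟨ filter-++ P? xs (a ∷ b ∷ ys) ⟩
    filter P? xs ++ filter P? (a ∷ b ∷ ys)   ≡⟨ cong (filter P? xs ++_) (filter-swap ys adj) ⟩
    filter P? xs ++ filter P? (b ∷ a ∷ ys)   ≡⟨ filter-++ P? xs (b ∷ a ∷ ys) ⟨
    filter P? (xs ++ b ∷ a ∷ ys)             ∎
    where open ≡-Reasoning

  ∼-filter : ∀ {u v} → u ∼ v → filter P? u ≡ filter P? v
  ∼-filter ε = refl
  ∼-filter (s ◅ p) = trans (Step-filter s) (∼-filter p)

∼-head : ∀ {x y u v} → x ∷ u ∼ y ∷ v → Near x y
∼-head {x} {y} {u} {v} p with near? x y
... | yes near = near
... | no ¬near = ⊥-elim (¬near (inj₁ (∷-injectiveˡ filtered)))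
  where
  P? : Decidable (λ z → z ≡ x ⊎ z ≡ y)
  P? z = (z ≟ x) ⊎-dec (z ≟ y)
  spread : ∀ {a b} → (a ≡ x ⊎ a ≡ y) → (b ≡ x ⊎ b ≡ y) → ¬ Adjacent a b
  spread (inj₁ refl) (inj₁ refl) adj = Adjacent⇒≢ adj refl
  spread (inj₂ refl) (inj₂ refl) adj = Adjacent⇒≢ adj refl
  spread (inj₁ refl) (inj₂ refl) adj = ¬near (inj₂ adj)
  spread (inj₂ refl) (inj₁ refl) adj = ¬near (inj₂ (Adjacent-sym adj))
  filtered : x ∷ filter P? u ≡ y ∷ filter P? v
  filtered = begin
    x ∷ filter P? u        ≡⟨ filter-accept P? (inj₁ refl) ⟨
    filter P? (x ∷ u)      ≡⟨ ∼-filter P? spread p ⟩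
    filter P? (y ∷ v)      ≡⟨ filter-accept P? (inj₂ refl) ⟩
    y ∷ filter P? v        ∎
    where open ≡-Reasoning

∼-last : ∀ {x y u v} → u ∷ʳ x ∼ v ∷ʳ y → Near x y
∼-last {x} {y} {u} {v} p = ∼-head (subst₂ _∼_ (reverse-++ u (x ∷ [])) (reverse-++ v (y ∷ [])) (∼-reverse p))

ascending : ℕ → ℕ → Word
ascending a zero = a ∷ []
ascending a (suc m) = a ∷ ascending (suc a) m

applyUpTo-ascending : ∀ (f : ℕ → ℕ) a m → (∀ i → f i ≡ a + i) → applyUpTo f (suc m) ≡ ascending a m
applyUpTo-ascending f a zero f≗a+ = cong (_∷ []) (trans (f≗a+ 0) (+-identityʳ a))
applyUpTo-ascending f a (suc m) f≗a+ = cong₂ _∷_ (trans (f≗a+ 0) (+-identityʳ a))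
  (applyUpTo-ascending (λ i → f (suc i)) (suc a) m (λ i → trans (f≗a+ (suc i)) (+-suc a i)))

map-upTo-ascending : ∀ a m → map (a +_) (upTo (suc m)) ≡ ascending a m
map-upTo-ascending a m = trans (map-upTo (a +_) (suc m)) (applyUpTo-ascending (a +_) a m (λ _ → refl))

length-ascending : ∀ a m → length (ascending a m) ≡ suc m
length-ascending a zero = refl
length-ascending a (suc m) = cong suc (length-ascending (suc a) m)

∈-ascending⁻ : ∀ {z} a m → z ∈ ascending a m → a ≤ z × z ≤ a + m
∈-ascending⁻ a zero (here refl) = ≤-refl , ≤-reflexive (sym (+-identityʳ a))
∈-ascending⁻ a (suc m) (here refl) = ≤-refl , m≤m+n a (suc m)
∈-ascending⁻ a (suc m) (there z∈) with ∈-ascending⁻ (suc a) m z∈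
... | a<z , z≤ = <⇒≤ a<z , ≤-trans z≤ (≤-reflexive (sym (+-suc a m)))

∈-ascending⁺ : ∀ {z} a m → a ≤ z → z ≤ a + m → z ∈ ascending a m
∈-ascending⁺ {z} a m a≤z z≤ with a ≟ z
∈-ascending⁺ a zero    _ _ | yes refl = here refl
∈-ascending⁺ a (suc m) _ _ | yes refl = here refl
∈-ascending⁺ a zero    a≤z z≤ | no a≢z = ⊥-elim (a≢z (≤-antisym a≤z (≤-trans z≤ (≤-reflexive (+-identityʳ a)))))
∈-ascending⁺ a (suc m) a≤z z≤ | no a≢z =
  there (∈-ascending⁺ (suc a) m (≤∧≢⇒< a≤z a≢z) (≤-trans z≤ (≤-reflexive (+-suc a m))))

ascending-++ : ∀ a m n → ascending a m ++ ascending (suc (a + m)) n ≡ ascending a (suc (m + n))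
ascending-++ a zero n = cong (λ k → a ∷ ascending (suc k) n) (+-identityʳ a)
ascending-++ a (suc m) n =
  cong (a ∷_) (trans (cong (λ k → ascending (suc a) m ++ ascending (suc k) n) (+-suc a m)) (ascending-++ (suc a) m n))

ascending-adjacent : ∀ a m (p : Word) y z q → ascending a m ≡ p ++ y ∷ z ∷ q → suc y ≡ z
ascending-adjacent a zero (_ ∷ _ ∷ _) y z q ()
ascending-adjacent a (suc zero) [] y z q refl = refl
ascending-adjacent a (suc (suc m)) [] y z q refl = refl
ascending-adjacent a (suc m) (_ ∷ p) y z q e = ascending-adjacent (suc a) m p y z q (∷-injectiveʳ e)

data Dir : Set where
  ↑ ↓ : Dir

run : Dir → ℕ → ℕ → Word
run ↑ a m = ascending a m
run ↓ a m = reverse (ascending a m)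

first last : Dir → ℕ → ℕ → ℕ
first ↑ a m = a
first ↓ a m = a + m
last ↑ a m = a + m
last ↓ a m = a

run-Run : ∀ d a m → Run (run d a m)
run-Run ↑ a m = inj₁ (a , m , sym (map-upTo-ascending a m))
run-Run ↓ a m = inj₂ (a , m , cong reverse (sym (map-upTo-ascending a m)))

Run⇒run : ∀ {r} → Run r → ∃ λ d → ∃₂ λ a m → r ≡ run d a m
Run⇒run (inj₁ (a , m , e)) = ↑ , a , m , trans e (map-upTo-ascending a m)
Run⇒run (inj₂ (a , m , e)) = ↓ , a , m , trans e (cong reverse (map-upTo-ascending a m))

length-run : ∀ d a m → length (run d a m) ≡ suc m
length-run ↑ a m = length-ascending a m
length-run ↓ a m = trans (length-reverse (ascending a m)) (length-ascending a m)

InRange : ℕ → ℕ → ℕ → Set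
InRange a m z = a ≤ z × z ≤ a + m

∈-run⁻ : ∀ {z} d a m → z ∈ run d a m → InRange a m z
∈-run⁻ ↑ a m z∈ = ∈-ascending⁻ a m z∈
∈-run⁻ ↓ a m z∈ = ∈-ascending⁻ a m (Any.reverse⁻ z∈)

∈-run⁺ : ∀ {z} d a m → InRange a m z → z ∈ run d a m
∈-run⁺ ↑ a m (a≤z , z≤) = ∈-ascending⁺ a m a≤z z≤
∈-run⁺ ↓ a m (a≤z , z≤) = Any.reverse⁺ (∈-ascending⁺ a m a≤z z≤)

ascending-first : ∀ a m → ∃ λ t → ascending a m ≡ a ∷ t
ascending-first a zero = [] , refl
ascending-first a (suc m) = ascending (suc a) m , refl

ascending-last : ∀ a m → ∃ λ p → ascending a m ≡ p ∷ʳ (a + m)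
ascending-last a zero = [] , cong (_∷ []) (sym (+-identityʳ a))
ascending-last a (suc m) with ascending-last (suc a) m
... | p , e = a ∷ p , cong (a ∷_) (trans e (cong (p ∷ʳ_) (sym (+-suc a m))))

run-first : ∀ d a m → ∃ λ t → run d a m ≡ first d a m ∷ t
run-first ↑ a m = ascending-first a m
run-first ↓ a m with ascending-last a m
... | p , e = reverse p , trans (cong reverse e) (reverse-++ p (a + m ∷ []))

run-last : ∀ d a m → ∃ λ p → run d a m ≡ p ∷ʳ last d a m
run-last ↑ a m = ascending-last a m
run-last ↓ a m with ascending-first a m
... | t , e = reverse t , trans (cong reverse e) (unfold-reverse a t)

Run-adjacent : ∀ {r} → Run r → ∀ p y z q → r ≡ p ++ y ∷ z ∷ q → Adjacent y z
Run-adjacent r-run p y z q e with Run⇒run r-run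
... | ↑ , a , m , refl = inj₁ (ascending-adjacent a m p y z q e)
... | ↓ , a , m , refl = inj₂ (ascending-adjacent a m (reverse q) z y (reverse p) (begin
  ascending a m                     ≡⟨ reverse-involutive (ascending a m) ⟨
  reverse (reverse (ascending a m)) ≡⟨ cong reverse e ⟩
  reverse (p ++ y ∷ z ∷ q)          ≡⟨ reverse-swap p y z q ⟩
  reverse q ++ z ∷ y ∷ reverse p    ∎))
  where open ≡-Reasoning

Near-+⇒≤1 : ∀ a m → Near a (a + m) → m ≤ 1
Near-+⇒≤1 a m (inj₁ e) = ≤-trans (≤-reflexive (+-cancelˡ-≡ a m 0 (trans (sym e) (sym (+-identityʳ a))))) z≤n
Near-+⇒≤1 a m (inj₂ (inj₁ e)) = ≤-reflexive (+-cancelˡ-≡ a m 1 (trans (sym e) (+-comm 1 a)))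
Near-+⇒≤1 a m (inj₂ (inj₂ e)) = ⊥-elim (m≢1+m+n a (sym e))

∼-run-first : ∀ d a m d′ a′ m′ → run d a m ∼ run d′ a′ m′ → Near (first d a m) (first d′ a′ m′)
∼-run-first d a m d′ a′ m′ p with run-first d a m | run-first d′ a′ m′
... | t , e | t′ , e′ = ∼-head (subst₂ _∼_ e e′ p)

∼-same-range⇒FlipRel : ∀ d d′ a m → run d′ a m ∼ run d a m → FlipRel (run d a m) (run d′ a m)
∼-same-range⇒FlipRel ↑ ↑ a m _ = inj₁ refl
∼-same-range⇒FlipRel ↓ ↓ a m _ = inj₁ refl
∼-same-range⇒FlipRel ↑ ↓ a zero _ = inj₁ refl
∼-same-range⇒FlipRel ↓ ↑ a zero _ = inj₁ refl
∼-same-range⇒FlipRel ↑ ↓ a (suc zero) _ = inj₂ (refl , refl)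
∼-same-range⇒FlipRel ↓ ↑ a (suc zero) _ = inj₂ (refl , refl)
-- a longer run and its reversal begin with the letters a + m and a, which are too far apart
∼-same-range⇒FlipRel ↑ ↓ a m@(suc (suc _)) p
  with s≤s () ← Near-+⇒≤1 a m (Near-sym (∼-run-first ↓ a m ↑ a m p))
∼-same-range⇒FlipRel ↓ ↑ a m@(suc (suc _)) p
  with s≤s () ← Near-+⇒≤1 a m (∼-run-first ↑ a m ↓ a m p)

∼-run⇒FlipRel : ∀ {r s} → Run r → Run s → s ∼ r → FlipRel r s
∼-run⇒FlipRel r-run s-run p with Run⇒run r-run | Run⇒run s-run
... | d , a , m , refl | d′ , a′ , m′ , refl = aligned (≤-antisym a≤a′ a′≤a) (suc-injective lengths) p
  where
  a≤a′ : a ≤ a′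
  a≤a′ = proj₁ (∈-run⁻ d a m (∼-∈ p (∈-run⁺ d′ a′ m′ (≤-refl , m≤m+n a′ m′))))
  a′≤a : a′ ≤ a
  a′≤a = proj₁ (∈-run⁻ d′ a′ m′ (∼-∈ (∼-sym p) (∈-run⁺ d a m (≤-refl , m≤m+n a m))))
  lengths : suc m′ ≡ suc m
  lengths = trans (sym (length-run d′ a′ m′)) (trans (∼-length p) (length-run d a m))
  aligned : a ≡ a′ → m′ ≡ m → run d′ a′ m′ ∼ run d a m → FlipRel (run d a m) (run d′ a′ m′)
  aligned refl refl = ∼-same-range⇒FlipRel d d′ a m

Run⇒NonEmpty : ∀ {r} → Run r → NonEmpty r
Run⇒NonEmpty r-run with d , a , m , refl ← Run⇒run r-run with t , e ← run-first d a m = first d a m , t , e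

-- Separated blocks

Separated : Word → Word → Set
Separated v₁ v₂ = ∀ {p x y s} → p ∷ʳ x ∼ v₁ → y ∷ s ∼ v₂ → ¬ Adjacent x y

data SwapSite (u₁ r xs : Word) (a b : ℕ) (ys : Word) : Set where
  in-right : ∀ xs′ → xs ≡ u₁ ++ xs′ → r ≡ xs′ ++ a ∷ b ∷ ys → SwapSite u₁ r xs a b ys
  in-left  : ∀ ys′ → u₁ ≡ xs ++ a ∷ b ∷ ys′ → ys ≡ ys′ ++ r → SwapSite u₁ r xs a b ys
  across   : u₁ ≡ xs ∷ʳ a → r ≡ b ∷ ys → SwapSite u₁ r xs a b ys

swap-site : ∀ u₁ r xs a b ys → u₁ ++ r ≡ xs ++ a ∷ b ∷ ys → SwapSite u₁ r xs a b ys
swap-site [] r xs a b ys e = in-right xs refl e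
swap-site (c ∷ []) r [] a b ys e with refl , e′ ← ∷-injective e = across refl e′
swap-site (c ∷ d ∷ u₁) r [] a b ys e with refl , e′ ← ∷-injective e with refl , e″ ← ∷-injective e′ =
  in-left u₁ refl (sym e″)
swap-site (c ∷ u₁) r (x ∷ xs) a b ys e with refl , e′ ← ∷-injective e with swap-site u₁ r xs a b ys e′
... | in-right xs′ refl r≡ = in-right xs′ refl r≡
... | in-left ys′ refl ys≡ = in-left ys′ refl ys≡
... | across refl r≡ = across refl r≡

concat-first-letter : ∀ {us vs b ys} → Pointwise _∼_ us vs → All NonEmpty vs → concat us ≡ b ∷ ys →
                      ∃₂ λ v vs′ → vs ≡ v ∷ vs′ × ∃ λ s → b ∷ s ∼ v
concat-first-letter [] [] ()
concat-first-letter (p ∷ _) (ne ∷ _) e with c , u , refl ← ∼-NonEmpty p ne with refl , _ ← ∷-injective e =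
  _ , _ , refl , u , p

FactorsAs-swap : ∀ {vs us} → Linked Separated vs → All NonEmpty vs → Pointwise _∼_ us vs →
                 ∀ xs a b ys → concat us ≡ xs ++ a ∷ b ∷ ys → Adjacent a b → FactorsAs (xs ++ b ∷ a ∷ ys) vs
FactorsAs-swap {[]} _ _ [] [] a b ys ()
FactorsAs-swap {[]} _ _ [] (_ ∷ _) a b ys ()
FactorsAs-swap {v₁ ∷ vs} {u₁ ∷ us} seps (_ ∷ nes) (p₁ ∷ ps) xs a b ys e adj
  with swap-site u₁ (concat us) xs a b ys e
... | in-right xs′ refl e′ with us′ , ps′ , e″ ← FactorsAs-swap (Linked.tail seps) nes ps xs′ a b ys e′ adj =
  u₁ ∷ us′ , p₁ ∷ ps′ , trans (cong (u₁ ++_) e″) (sym (++-assoc u₁ xs′ (b ∷ a ∷ ys)))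
... | in-left ys′ refl refl =
  (xs ++ b ∷ a ∷ ys′) ∷ us , (swap xs ys′ b a (Adjacent-sym adj) ◅ p₁) ∷ ps , ++-assoc xs (b ∷ a ∷ ys′) (concat us)
... | across refl e′ with concat-first-letter ps nes e′
...   | _ , _ , refl , _ , p₂ = ⊥-elim (Linked.head seps p₁ p₂ adj)

FactorsAs-∼ : ∀ {vs u u′} → Linked Separated vs → All NonEmpty vs → FactorsAs u vs → u ∼ u′ → FactorsAs u′ vs
FactorsAs-∼ seps nes f ε = f
FactorsAs-∼ seps nes (us , ps , e) (swap xs ys a b adj ◅ p) =
  FactorsAs-∼ seps nes (FactorsAs-swap seps nes ps xs a b ys e adj) p

-- Existence

Ascendable Descendable : Dir → ℕ → Set
Ascendable d m = d ≡ ↑ ⊎ m ≤ 1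
Descendable d m = d ≡ ↓ ⊎ m ≤ 1

ascendable? : ∀ d m → Dec (Ascendable d m)
ascendable? ↑ m = yes (inj₁ refl)
ascendable? ↓ m = map′ inj₂ (λ { (inj₁ ()) ; (inj₂ m≤1) → m≤1 }) (m ≤? 1)

descendable? : ∀ d m → Dec (Descendable d m)
descendable? ↓ m = yes (inj₁ refl)
descendable? ↑ m = map′ inj₂ (λ { (inj₁ ()) ; (inj₂ m≤1) → m≤1 }) (m ≤? 1)

run-∼-ascending : ∀ d a m → Ascendable d m → run d a m ∼ ascending a m
run-∼-ascending ↑ a m _ = ε
run-∼-ascending ↓ a zero _ = ε
run-∼-ascending ↓ a (suc zero) _ = swap [] [] (suc a) a (inj₂ refl) ◅ ε
run-∼-ascending ↓ a (suc (suc m)) (inj₂ (s≤s ()))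

run-∼-descending : ∀ d a m → Descendable d m → run d a m ∼ reverse (ascending a m)
run-∼-descending ↓ a m _ = ε
run-∼-descending ↑ a zero _ = ε
run-∼-descending ↑ a (suc zero) _ = swap [] [] a (suc a) (inj₁ refl) ◅ ε
run-∼-descending ↑ a (suc (suc m)) (inj₂ (s≤s ()))

ascendable-last : ∀ d a m → Near (a + m) (last d a m) → Ascendable d m
ascendable-last ↑ a m _ = inj₁ refl
ascendable-last ↓ a m near = inj₂ (Near-+⇒≤1 a m (Near-sym near))

ascendable-first : ∀ d a m → Near a (first d a m) → Ascendable d m
ascendable-first ↑ a m _ = inj₁ refl
ascendable-first ↓ a m near = inj₂ (Near-+⇒≤1 a m near)

descendable-last : ∀ d a m → Near a (last d a m) → Descendable d m
descendable-last ↓ a m _ = inj₁ refl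
descendable-last ↑ a m near = inj₂ (Near-+⇒≤1 a m near)

descendable-first : ∀ d a m → Near (a + m) (first d a m) → Descendable d m
descendable-first ↓ a m _ = inj₁ refl
descendable-first ↑ a m near = inj₂ (Near-+⇒≤1 a m (Near-sym near))

-- (d , a , m) is the run of direction d on the letters a, …, a + m
Block : Set
Block = Dir × ℕ × ℕ

word : Block → Word
word (d , a , m) = run d a m

words : List Block → List Word
words = map word

Mergeable : Block → Block → Set
Mergeable (d , a , m) (d′ , c , n) =
  c ≡ suc (a + m) × Ascendable d m × Ascendable d′ n ⊎ a ≡ suc (c + n) × Descendable d m × Descendable d′ n

mergeable? : ∀ b c → Dec (Mergeable b c)
mergeable? (d , a , m) (d′ , c , n) =
  (c ≟ suc (a + m) ×-dec ascendable? d m ×-dec ascendable? d′ n) ⊎-dec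
  (a ≟ suc (c + n) ×-dec descendable? d m ×-dec descendable? d′ n)

merge : ∀ b c → Mergeable b c → Σ Block λ e → word b ++ word c ∼ word e
merge (d , a , m) (d′ , _ , n) (inj₁ (refl , asc , asc′)) =
  (↑ , a , suc (m + n)) ,
  subst (run d a m ++ run d′ _ n ∼_) (ascending-++ a m n) (∼-++ (run-∼-ascending d a m asc) (run-∼-ascending d′ _ n asc′))
merge (d , _ , m) (d′ , c , n) (inj₂ (refl , desc , desc′)) =
  (↓ , c , suc (n + m)) ,
  subst (run d _ m ++ run d′ c n ∼_)
    (trans (sym (reverse-++ (ascending c n) (ascending _ m))) (cong reverse (ascending-++ c n m)))
    (∼-++ (run-∼-descending d _ m desc) (run-∼-descending d′ c n desc′))

facing-ends : ∀ {a m c n x y} → (∀ {z} → InRange a m z → InRange c n z → ⊥) →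
              InRange a m x → InRange c n y → suc x ≡ y → x ≡ a + m × y ≡ c
facing-ends {x = x} disjoint (a≤x , x≤) (c≤y , y≤) refl = top , bottom
  where
  top : x ≡ _
  top with m≤n⇒m<n∨m≡n x≤
  ... | inj₂ x≡ = x≡
  ... | inj₁ x< = ⊥-elim (disjoint (≤-trans a≤x (n≤1+n x) , x<) (c≤y , y≤))
  bottom : suc x ≡ _
  bottom with m≤n⇒m<n∨m≡n c≤y
  ... | inj₂ c≡ = sym c≡
  ... | inj₁ c< = ⊥-elim (disjoint (a≤x , x≤) (≤-pred c< , ≤-trans (n≤1+n x) y≤))

adjacent-ends⇒Mergeable : ∀ d a m d′ c n {x y} → (∀ {z} → InRange a m z → InRange c n z → ⊥) →
                          InRange a m x → InRange c n y → Near x (last d a m) → Near y (first d′ c n) →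
                          Adjacent x y → Mergeable (d , a , m) (d′ , c , n)
adjacent-ends⇒Mergeable d a m d′ c n disjoint x∈ y∈ x-near y-near (inj₁ x+1≡y)
  with refl , refl ← facing-ends disjoint x∈ y∈ x+1≡y =
  inj₁ (sym x+1≡y , ascendable-last d a m x-near , ascendable-first d′ c n y-near)
adjacent-ends⇒Mergeable d a m d′ c n disjoint x∈ y∈ x-near y-near (inj₂ y+1≡x)
  with refl , refl ← facing-ends (λ z∈c z∈a → disjoint z∈a z∈c) y∈ x∈ y+1≡x =
  inj₂ (sym y+1≡x , descendable-last d a m x-near , descendable-first d′ c n y-near)

disjoint-unmergeable⇒Separated : ∀ b c → (∀ {z} → z ∈ word b → z ∈ word c → ⊥) → ¬ Mergeable b c →
                                 Separated (word b) (word c)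
disjoint-unmergeable⇒Separated (d , a , m) (d′ , c , n) disjoint unmergeable {p} {x} {y} {s} px∼ ys∼ adj =
  unmergeable (adjacent-ends⇒Mergeable d a m d′ c n
    (λ z∈a z∈c → disjoint (∈-run⁺ d a m z∈a) (∈-run⁺ d′ c n z∈c))
    (∈-run⁻ d a m (∼-∈ px∼ (∈-++⁺ʳ p (here refl))))
    (∈-run⁻ d′ c n (∼-∈ ys∼ (here refl)))
    x-near y-near adj)
  where
  x-near : Near x (last d a m)
  x-near with q , e ← run-last d a m = ∼-last (subst (p ∷ʳ x ∼_) e px∼)
  y-near : Near y (first d′ c n)
  y-near with t , e ← run-first d′ c n = ∼-head (subst (y ∷ s ∼_) e ys∼)

insert : ∀ b cs → Linked Separated (words cs) → Unique (word b ++ concat (words cs)) →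
         Σ (List Block) λ ds → Linked Separated (words ds) × word b ++ concat (words cs) ∼ concat (words ds)
insert b [] _ _ = b ∷ [] , [-] , ε
insert b (c ∷ cs) seps distinct with mergeable? b c
... | no unmergeable = b ∷ c ∷ cs , disjoint-unmergeable⇒Separated b c disjoint unmergeable ∷ seps , ε
  where
  disjoint : ∀ {z} → z ∈ word b → z ∈ word c → ⊥
  disjoint z∈b z∈c = Unique-++-disjoint (word b) distinct z∈b (∈-++⁺ˡ z∈c)
... | yes mergeable
  with e , merged ← merge b c mergeable
  with ds , seps′ , e∼ds ← insert e cs (Linked.tail seps)
         (∼-Unique (∼-++ʳ _ merged) (subst Unique (sym (++-assoc (word b) (word c) _)) distinct)) =
  ds , seps′ , subst (_∼ concat (words ds)) assoc (∼-++ʳ rest merged ◅◅ e∼ds)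
  where
  rest = concat (words cs)
  assoc : (word b ++ word c) ++ rest ≡ word b ++ word c ++ rest
  assoc = ++-assoc (word b) (word c) rest

normalise : ∀ w → Unique w → Σ (List Block) λ bs → Linked Separated (words bs) × w ∼ concat (words bs)
normalise [] _ = [] , [] , ε
normalise (x ∷ w) (x∉w ∷ distinct)
  with bs , seps , w∼bs ← normalise w distinct
  with ds , seps′ , x∷bs∼ds ← insert (↑ , x , 0) bs seps (∼-Unique (∼-++ˡ (x ∷ []) w∼bs) (x∉w ∷ distinct)) =
  ds , seps′ , ∼-++ˡ (x ∷ []) w∼bs ◅◅ x∷bs∼ds

words-Run : ∀ bs → All Run (words bs)
words-Run bs = map⁺ (universal (λ (d , a , m) → run-Run d a m) bs)

words-NonEmpty : ∀ bs → All NonEmpty (words bs)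
words-NonEmpty bs = All.map Run⇒NonEmpty (words-Run bs)

-- Uniqueness

++-≡-equal-length : ∀ (xs ys : Word) {r s} → length xs ≡ length ys → xs ++ r ≡ ys ++ s → xs ≡ ys × r ≡ s
++-≡-equal-length [] [] _ e = refl , e
++-≡-equal-length (x ∷ xs) (y ∷ ys) lengths e with refl , e′ ← ∷-injective e
  with refl , r≡s ← ++-≡-equal-length xs ys (suc-injective lengths) e′ = refl , r≡s

++-≡-shorter : ∀ (xs ys : Word) {r s} → xs ++ r ≡ ys ++ s → length xs < length ys → ∃₂ λ z t → ys ≡ xs ++ z ∷ t
++-≡-shorter [] (y ∷ ys) _ _ = y , ys , refl
++-≡-shorter (x ∷ xs) (y ∷ ys) e (s≤s shorter) with refl , e′ ← ∷-injective e
  with z , t , refl ← ++-≡-shorter xs ys e′ shorter = z , t , refl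

StepClosed : (Word → Set) → Set
StepClosed Q = ∀ {u v} → Q u → Step u v → Q v

AllFactorAs : (Word → Set) → List Word → Set
AllFactorAs Q vs = ∀ u → Q u → FactorsAs u vs

AllFactorAs-drop-first : ∀ {Q v vs} p → length v ≡ length p → AllFactorAs Q (v ∷ vs) →
                         AllFactorAs (λ u → Q (p ++ u)) vs
AllFactorAs-drop-first p lengths factors u q with x₁ ∷ xs , x₁∼v ∷ ps , e ← factors _ q
  with refl , e′ ← ++-≡-equal-length x₁ p (trans (∼-length x₁∼v) lengths) e = xs , ps , e′

module _ {Q : Word → Set} (closed : StepClosed Q) (distinct : ∀ {u} → Q u → Unique u) where

  closed-∼ : ∀ {u v} → Q u → u ∼ v → Q v
  closed-∼ q ε = q
  closed-∼ q (s ◅ p) = closed-∼ (closed q s) p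

  AllFactorAs-concat : ∀ {vs u} → AllFactorAs Q vs → Q u → Q (concat vs)
  AllFactorAs-concat factors q with us , ps , refl ← factors _ q = closed-∼ q (∼-concat ps)

  -- after the swap, the first factor i ∷ʳ z has to have the letters of v, i.e. of i ∷ʳ y
  swap-breaks-first-block : ∀ {v vs i y z R} → AllFactorAs Q (v ∷ vs) → i ∷ʳ y ∼ v → Adjacent y z →
                            ¬ Q (i ++ y ∷ z ∷ R)
  swap-breaks-first-block {i = i} {y} {z} {R} factors iy∼v adj q
    with x₁ ∷ _ , x₁∼v ∷ _ , e ← factors _ (closed q (swap i R y z adj))
    with refl , _ ← ++-≡-equal-length x₁ (i ∷ʳ z)
                      (trans (∼-length x₁∼v) (trans (sym (∼-length iy∼v)) (trans (length-++ i) (sym (length-++ i)))))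
                      (trans e (sym (++-assoc i (z ∷ []) (y ∷ R))))
    with ∈-++⁻ i (∼-∈ (∼-sym iy∼v) (∼-∈ x₁∼v (∈-++⁺ʳ i (here refl))))
  ... | inj₁ z∈i = Unique-++-disjoint i (distinct q) z∈i (there (here refl))
  ... | inj₂ (here z≡y) = Adjacent⇒≢ adj (sym z≡y)

  first-block-not-shorter : ∀ {v v′ vs R} → Run v′ → NonEmpty v → AllFactorAs Q (v ∷ vs) → Q (v′ ++ R) →
                            ¬ (length v < length v′)
  first-block-not-shorter {v′ = v′} {R = R} v′-run v-nonempty factors q shorter
    with u₁ ∷ _ , u₁∼v ∷ _ , e ← factors _ q
    with z , t , refl ← ++-≡-shorter u₁ v′ e (subst (_< length v′) (sym (∼-length u₁∼v)) shorter)
    with initLast u₁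
  ... | [] with _ , _ , () ← ∼-NonEmpty u₁∼v v-nonempty
  ... | i ∷ʳ′ y =
    swap-breaks-first-block factors u₁∼v adj (subst Q (++-assoc i (y ∷ z ∷ t) R) (subst (λ r → Q (r ++ R)) split q))
    where
    split : (i ∷ʳ y) ++ z ∷ t ≡ i ++ y ∷ z ∷ t
    split = ++-assoc i (y ∷ []) (z ∷ t)
    adj : Adjacent y z
    adj = Run-adjacent v′-run i y z t split

decomposition-unique : ∀ {Q} → StepClosed Q → (∀ {u} → Q u → Unique u) → ∀ {w} → Q w →
                       ∀ vs vs′ → All Run vs → All Run vs′ → AllFactorAs Q vs → AllFactorAs Q vs′ →
                       Σ (List Word) λ ws → Pointwise FlipRel vs ws × concat ws ≡ concat vs′
decomposition-unique closed distinct q [] vs′ _ _ factors factors′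
  with [] , [] , e ← factors _ (AllFactorAs-concat closed distinct factors′ q) = [] , [] , e
decomposition-unique closed distinct q (v ∷ vs) [] (v-run ∷ _) _ factors factors′
  with [] ∷ _ , u₁∼v ∷ _ , _ ← factors _ (AllFactorAs-concat closed distinct factors′ q)
  with _ , _ , () ← ∼-NonEmpty u₁∼v (Run⇒NonEmpty v-run)
decomposition-unique closed distinct q (v ∷ vs) (v′ ∷ vs′) (v-run ∷ runs) (v′-run ∷ runs′) factors factors′
  with <-cmp (length v) (length v′)
... | tri< shorter _ _ = ⊥-elim (first-block-not-shorter closed distinct v′-run (Run⇒NonEmpty v-run) factors
                                   (AllFactorAs-concat closed distinct factors′ q) shorter)
... | tri> _ _ longer = ⊥-elim (first-block-not-shorter closed distinct v-run (Run⇒NonEmpty v′-run) factors′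
                                  (AllFactorAs-concat closed distinct factors q) longer)
... | tri≈ _ same-length _
  with u₁ ∷ _ , u₁∼v ∷ _ , e ← factors _ (AllFactorAs-concat closed distinct factors′ q)
  with refl , _ ← ++-≡-equal-length u₁ v′ (trans (∼-length u₁∼v) same-length) e
  with ws , flips , e′ ← decomposition-unique (λ q s → closed q (Step-++ˡ v′ s)) (λ q → Unique-++⁻ʳ v′ (distinct q))
                           (AllFactorAs-concat closed distinct factors′ q) vs vs′ runs runs′
                           (AllFactorAs-drop-first v′ same-length factors) (AllFactorAs-drop-first v′ refl factors′) =
  v′ ∷ ws , ∼-run⇒FlipRel v-run v′-run u₁∼v ∷ flips , cong (v′ ++_) e′

lemma2p7 : (w : List ℕ) → Unique w → All (λ x → 0 < x) w →
           Σ (List Word) (λ vs → GoodDecomp w vs)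
           × ((vs vs′ : List Word) → GoodDecomp w vs → GoodDecomp w vs′ →
                Σ (List Word) (λ ws → Pointwise FlipRel vs ws × concat ws ≡ concat vs′))
lemma2p7 w distinct _ with bs , seps , w∼bs ← normalise w distinct =
  (words bs , w∼bs , words-Run bs , factors) , unique
  where
  factors : AllFactorAs (w ∼_) (words bs)
  factors u w∼u = FactorsAs-∼ seps (words-NonEmpty bs) (words bs , Pointwise.refl ε , refl) (∼-sym w∼bs ◅◅ w∼u)
  unique : (vs vs′ : List Word) → GoodDecomp w vs → GoodDecomp w vs′ →
           Σ (List Word) (λ ws → Pointwise FlipRel vs ws × concat ws ≡ concat vs′)
  unique vs vs′ (_ , runs , factors) (_ , runs′ , factors′) =
    decomposition-unique ∼-snoc (λ w∼u → ∼-Unique w∼u distinct) ε vs vs′ runs runs′ factors factors′
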